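{- Let $k\ge 1$ be an integer and let $T$ be any tree with $n>2$ vertices. Then $\beta_k(T)\le \beta_k(S_n)$, where $S_n$ is the star graph on $n$ vertices (i.e. $K_{1,n-1}$).
   Context: For a graph $G=(V,E)$ with geodesic (shortest-path) distance $d$, and an integer $k\ge 0$, define $d_k(u,v):=\min\{d(u,v),k+1\}$. A non-empty set $R\subseteq V$ is a $k$-truncated resolving set of $G$ if for all $u,v\in V$, $d_k(u,r)=d_k(v,r)$ for every $r\in R$ implies $u=v$. The $k$-truncated metric dimension $\beta_k(G)$ is the minimum size of a $k$-truncated resolving set of $G$. -}

module Defs where

open import Data.Nat using (ℕ; zero; suc; _+_; _≤_)
open import Data.Bool using (Bool; true; false; _∨_; _∧_; if_then_else_; not)
open import Data.Fin using (Fin; zero; suc; inject₁; fromℕ; _≟_)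
open import Data.Fin.Subset using (Subset; _∈_; ∣_∣; Nonempty)
open import Data.Product using (Σ; ∃; ∃-syntax; _×_; _,_)
open import Data.Empty using (⊥)
open import Relation.Nullary using (¬_; does)
open import Relation.Binary.PropositionalEquality using (_≡_; refl)
open import Function.Definitions using (Injective)

record Graph (n : ℕ) : Set where
  field
    adj   : Fin n → Fin n → Bool
    sym   : ∀ u v → adj u v ≡ adj v u
    irrfl : ∀ u → adj u u ≡ false

open Graph public

anyFin : ∀ {n} → (Fin n → Bool) → Bool
anyFin {zero}  f = false
anyFin {suc n} f = f zero ∨ anyFin (λ i → f (suc i))

module _ {n : ℕ} (G : Graph n) where

  reach : ℕ → Fin n → Fin n → Bool
  reach zero    u v = does (u ≟ v)
  reach (suc m) u v = reach m u v ∨ anyFin (λ w → reach m u w ∧ adj G w v)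

  firstReach : Fin n → Fin n → (fuel start : ℕ) → ℕ
  firstReach u v zero     start = start
  firstReach u v (suc f)  start =
    if reach start u v then start else firstReach u v f (suc start)

  -- geodesic distance truncated at k+1:  d_k(u,v) = min { d(u,v), k+1 }
  -- (with d(u,v) = ∞ when u,v lie in different components)
  dtrunc : ℕ → Fin n → Fin n → ℕ
  dtrunc k u v = firstReach u v (suc k) 0

  Connected : Set
  Connected = ∀ u v → ∃[ m ] (reach m u v ≡ true)

  -- a cycle of length m+3: distinct vertices c 0, …, c (m+2), consecutive
  -- ones adjacent and c (m+2) adjacent to c 0
  record Cycle (m : ℕ) : Set where
    field
      c     : Fin (suc (suc (suc m))) → Fin n
      inj   : Injective _≡_ _≡_ c
      steps : ∀ (i : Fin (suc (suc m))) → adj G (c (inject₁ i)) (c (suc i)) ≡ true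
      close : adj G (c (fromℕ (suc (suc m)))) (c zero) ≡ true

  Acyclic : Set
  Acyclic = ∀ m → ¬ Cycle m

  IsTree : Set
  IsTree = Connected × Acyclic

  IsTruncResolving : ℕ → Subset n → Set
  IsTruncResolving k R =
    Nonempty R ×
    (∀ u v → (∀ r → r ∈ R → dtrunc k u r ≡ dtrunc k v r) → u ≡ v)

  IsTruncMetricDim : ℕ → ℕ → Set
  IsTruncMetricDim k b =
    (∃[ R ] (IsTruncResolving k R × ∣ R ∣ ≡ b)) ×
    (∀ R → IsTruncResolving k R → b ≤ ∣ R ∣)

starAdj : ∀ {n} → Fin n → Fin n → Bool
starAdj zero    zero    = false
starAdj zero    (suc _) = true
starAdj (suc _) zero    = true
starAdj (suc _) (suc _) = false

star : (n : ℕ) → Graph n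
star n = record { adj = starAdj ; sym = s ; irrfl = i }
  where
    s : ∀ u v → starAdj u v ≡ starAdj v u
    s zero zero = refl
    s zero (suc _) = refl
    s (suc _) zero = refl
    s (suc _) (suc _) = refl
    i : ∀ u → starAdj u u ≡ false
    i zero = refl
    i (suc _) = refl

module Submission where

-- A tree T on n ≥ 3 vertices contains a path a–b–c, and a, c are not adjacent since T
-- has no triangle; so c is at truncated distance 1 from b but not from a (here k ≥ 1
-- matters). Then V ∖ {a, b} resolves T: a vertex of it is the only one at distance 0
-- from itself, and c separates a from b. Hence β_k(T) ≤ n − 2. In the star, two leaves
-- ℓ, ℓ′ are at distance 1 from the centre and 2 from every other leaf, so every
-- resolving set misses at most one leaf besides the centre and β_k(S_n) ≥ n − 2.

open import Defs hiding (sym)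
open import Data.Nat using (ℕ; zero; suc; _+_; _∸_; _≤_; _<_; z≤n; s≤s)
open import Data.Nat.Properties using (≤-trans; +-suc; +-identityʳ; n≮n; +-cancelˡ-≤)
open import Data.Bool using (Bool; true; false; _∨_; _∧_)
open import Data.Bool.Properties using (∨-zeroʳ; ¬-not)
open import Data.Fin using (Fin; zero; suc; inject₁; _≟_)
open import Data.Fin.Properties using (suc-injective)
open import Data.Fin.Subset using (Subset; inside; outside; _∈_; _∉_; _⊆_; ⊤; ∁; ⁅_⁆; _-_; ∣_∣)
open import Data.Fin.Subset.Properties
  using (_∈?_; drop-there; ∣p∣≤∣x∷p∣; ∣⊤∣≡n; ∣∁p∣≡n∸∣p∣; ∣⁅x⁆∣≡1; p⊆q⇒∣p∣≤∣q∣; x∈p⇒∣p-x∣<∣p∣;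
         x∈p∧x≢y⇒x∈p-y; x∉p⇒x∈∁p; x≢y⇒x∉⁅y⁆)
open import Data.Vec using (_∷_)
open import Data.Product using (∃-syntax; _×_; _,_)
open import Data.Sum using (_⊎_; inj₁; inj₂)
open import Data.Empty using (⊥)
open import Function using (_∘_)
open import Relation.Nullary using (yes; no; contradiction)
open import Relation.Nullary.Decidable using (dec-true; dec-false)
open import Relation.Binary.PropositionalEquality
  using (_≡_; _≢_; refl; sym; trans; cong; subst; module ≡-Reasoning)

∨-true⁻ : ∀ {a b} → a ∨ b ≡ true → a ≡ true ⊎ b ≡ true
∨-true⁻ {true}  _ = inj₁ refl
∨-true⁻ {false} e = inj₂ e

∨-true⁺ʳ : ∀ a {b} → b ≡ true → a ∨ b ≡ true
∨-true⁺ʳ a refl = ∨-zeroʳ a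

∧-true⁻ : ∀ {a b} → a ∧ b ≡ true → a ≡ true × b ≡ true
∧-true⁻ {true} e = refl , e

∧-true⁺ : ∀ {a b} → a ≡ true → b ≡ true → a ∧ b ≡ true
∧-true⁺ refl refl = refl

anyFin-true⁻ : ∀ {n} (f : Fin n → Bool) → anyFin f ≡ true → ∃[ i ] f i ≡ true
anyFin-true⁻ {suc n} f e with ∨-true⁻ {f zero} e
... | inj₁ f0 = zero , f0
... | inj₂ rest with anyFin-true⁻ (f ∘ suc) rest
...   | i , fi = suc i , fi

anyFin-true⁺ : ∀ {n} (f : Fin n → Bool) i → f i ≡ true → anyFin f ≡ true
anyFin-true⁺ f zero    fi rewrite fi = refl
anyFin-true⁺ f (suc i) fi = ∨-true⁺ʳ (f zero) (anyFin-true⁺ (f ∘ suc) i fi)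

module _ {n : ℕ} (G : Graph n) where

  adj⇒≢ : ∀ {u v} → adj G u v ≡ true → u ≢ v
  adj⇒≢ {u} e refl with trans (sym e) (irrfl G u)
  ... | ()

  reach-zero⁻ : ∀ {u v} → reach G 0 u v ≡ true → u ≡ v
  reach-zero⁻ {u} {v} e with u ≟ v
  ... | yes u≡v = u≡v
  ... | no _    = contradiction e λ ()

  reach-one⁻ : ∀ {u v} → reach G 1 u v ≡ true → u ≡ v ⊎ adj G u v ≡ true
  reach-one⁻ {u} {v} e with ∨-true⁻ e
  ... | inj₁ u≡v = inj₁ (reach-zero⁻ u≡v)
  ... | inj₂ step with anyFin-true⁻ _ step
  ...   | w , uw with ∧-true⁻ {reach G 0 u w} uw
  ...     | u≡w , adj-wv with reach-zero⁻ {u} {w} u≡w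
  ...       | refl = inj₂ adj-wv

  reach-one⁺ : ∀ {u v} → adj G u v ≡ true → reach G 1 u v ≡ true
  reach-one⁺ {u} e = ∨-true⁺ʳ _ (anyFin-true⁺ _ u (∧-true⁺ (dec-true (u ≟ u) refl) e))

  reach-two⁺ : ∀ {u w v} → adj G u w ≡ true → adj G w v ≡ true → reach G 2 u v ≡ true
  reach-two⁺ {w = w} uw wv = ∨-true⁺ʳ _ (anyFin-true⁺ _ w (∧-true⁺ (reach-one⁺ uw) wv))

  firstReach-hit : ∀ u v s → reach G s u v ≡ true → ∀ f → firstReach G u v f s ≡ s
  firstReach-hit u v s r zero    = refl
  firstReach-hit u v s r (suc f) rewrite r = refl

  firstReach-miss : ∀ u v s f → reach G s u v ≡ false →
                    firstReach G u v (suc f) s ≡ firstReach G u v f (suc s)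
  firstReach-miss u v s f r rewrite r = refl

  firstReach-reaches : ∀ u v f s → firstReach G u v f s < s + f →
                       reach G (firstReach G u v f s) u v ≡ true
  firstReach-reaches u v zero    s lt = contradiction (subst (s <_) (+-identityʳ s) lt) (n≮n s)
  firstReach-reaches u v (suc f) s lt with reach G s u v in r
  ... | true  = r
  ... | false =
    firstReach-reaches u v f (suc s) (subst (firstReach G u v f (suc s) <_) (+-suc s f) lt)

  dtrunc-reaches : ∀ k u v {j} → dtrunc G k u v ≡ j → j ≤ k → reach G j u v ≡ true
  dtrunc-reaches k u v refl j≤k = firstReach-reaches u v (suc k) 0 (s≤s j≤k)

  dtrunc≡0⇒≡ : ∀ k {u v} → dtrunc G k u v ≡ 0 → u ≡ v
  dtrunc≡0⇒≡ k {u} {v} e = reach-zero⁻ (dtrunc-reaches k u v e z≤n)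

  dtrunc≡1⇒ : ∀ k {u v} → dtrunc G (suc k) u v ≡ 1 → u ≡ v ⊎ adj G u v ≡ true
  dtrunc≡1⇒ k {u} {v} e = reach-one⁻ (dtrunc-reaches (suc k) u v e (s≤s z≤n))

  dtrunc-refl : ∀ k u → dtrunc G k u u ≡ 0
  dtrunc-refl k u = firstReach-hit u u 0 (dec-true (u ≟ u) refl) (suc k)

  dtrunc-adj : ∀ k {u v} → adj G u v ≡ true → dtrunc G (suc k) u v ≡ 1
  dtrunc-adj k {u} {v} uv = trans (firstReach-miss u v 0 (suc k) (dec-false (u ≟ v) (adj⇒≢ uv)))
                                  (firstReach-hit u v 1 (reach-one⁺ uv) (suc k))

  dtrunc-two : ∀ k {u v} w → u ≢ v → adj G u v ≡ false →
               adj G u w ≡ true → adj G w v ≡ true → dtrunc G (suc k) u v ≡ 2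
  dtrunc-two k {u} {v} w u≢v ¬uv uw wv = begin
    firstReach G u v (suc (suc k)) 0 ≡⟨ firstReach-miss u v 0 (suc k) (dec-false (u ≟ v) u≢v) ⟩
    firstReach G u v (suc k) 1       ≡⟨ firstReach-miss u v 1 k (¬-not ¬reach-one) ⟩
    firstReach G u v k 2             ≡⟨ firstReach-hit u v 2 (reach-two⁺ uw wv) k ⟩
    2                                ∎
    where
      open ≡-Reasoning
      ¬reach-one : reach G 1 u v ≢ true
      ¬reach-one r with reach-one⁻ r
      ... | inj₁ u≡v = u≢v u≡v
      ... | inj₂ uv  = contradiction (trans (sym uv) ¬uv) λ ()

  module _ {k : ℕ} {a b c : Fin n} (c≢a : c ≢ a) (c≢b : c ≢ b)
           (separates : dtrunc G k a c ≢ dtrunc G k b c) where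

    private
      R : Subset n
      R = ∁ ⁅ a ⁆ - b

      ∈R : ∀ {x} → x ≢ a → x ≢ b → x ∈ R
      ∈R x≢a x≢b = x∈p∧x≢y⇒x∈p-y (x∉p⇒x∈∁p (x≢y⇒x∉⁅y⁆ x≢a)) x≢b

      ∉R : ∀ {x} → x ∉ R → x ≡ a ⊎ x ≡ b
      ∉R {x} x∉R with x ≟ a | x ≟ b
      ... | yes x≡a | _       = inj₁ x≡a
      ... | no _    | yes x≡b = inj₂ x≡b
      ... | no x≢a  | no x≢b  = contradiction (∈R x≢a x≢b) x∉R

    ∁pair-resolving : IsTruncResolving G k (∁ ⁅ a ⁆ - b)
    ∁pair-resolving = (c , ∈R c≢a c≢b) , resolves
      where
        resolves : ∀ u v → (∀ r → r ∈ R → dtrunc G k u r ≡ dtrunc G k v r) → u ≡ v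
        resolves u v same with u ∈? R | v ∈? R
        ... | yes u∈R | _ = sym (dtrunc≡0⇒≡ k (trans (sym (same u u∈R)) (dtrunc-refl k u)))
        ... | _ | yes v∈R = dtrunc≡0⇒≡ k (trans (same v v∈R) (dtrunc-refl k v))
        ... | no u∉R | no v∉R with ∉R u∉R | ∉R v∉R
        ...   | inj₁ refl | inj₁ refl = refl
        ...   | inj₂ refl | inj₂ refl = refl
        ...   | inj₁ refl | inj₂ refl = contradiction (same c (∈R c≢a c≢b)) separates
        ...   | inj₂ refl | inj₁ refl = contradiction (sym (same c (∈R c≢a c≢b))) separates

∣∁⁅x⁆-y∣+2≤n : ∀ {n} {x y : Fin n} → x ≢ y → 2 + ∣ ∁ ⁅ x ⁆ - y ∣ ≤ n
∣∁⁅x⁆-y∣+2≤n {suc n} {x} {y} x≢y = s≤s (subst (∣ ∁ ⁅ x ⁆ - y ∣ <_) ∣∁⁅x⁆∣≡n shrinks)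
  where
    shrinks : ∣ ∁ ⁅ x ⁆ - y ∣ < ∣ ∁ ⁅ x ⁆ ∣
    shrinks = x∈p⇒∣p-x∣<∣p∣ (x∉p⇒x∈∁p (x≢y⇒x∉⁅y⁆ (x≢y ∘ sym)))
    ∣∁⁅x⁆∣≡n : ∣ ∁ ⁅ x ⁆ ∣ ≡ n
    ∣∁⁅x⁆∣≡n = trans (∣∁p∣≡n∸∣p∣ ⁅ x ⁆) (cong (suc n ∸_) (∣⁅x⁆∣≡1 x))

∉-unique⇒n≤1+∣p∣ : ∀ {n} (p : Subset n) → (∀ {i j} → i ∉ p → j ∉ p → i ≡ j) → n ≤ suc ∣ p ∣
∉-unique⇒n≤1+∣p∣ {zero}  []            _    = z≤n
∉-unique⇒n≤1+∣p∣ {suc n} (inside  ∷ p) uniq =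
  s≤s (∉-unique⇒n≤1+∣p∣ p λ i∉p j∉p → suc-injective (uniq (i∉p ∘ drop-there) (j∉p ∘ drop-there)))
∉-unique⇒n≤1+∣p∣ {suc n} (outside ∷ p) uniq = s≤s (subst (_≤ ∣ p ∣) (∣⊤∣≡n n) (p⊆q⇒∣p∣≤∣q∣ ⊤⊆p))
  where
    ⊤⊆p : ⊤ ⊆ p
    ⊤⊆p {j} _ with j ∈? p
    ... | yes j∈p = j∈p
    ... | no  j∉p = contradiction (uniq {zero} (λ ()) (j∉p ∘ drop-there)) λ ()

record Path₃ {n : ℕ} (G : Graph n) : Set where
  field
    {a b c} : Fin n
    ab      : adj G a b ≡ true
    bc      : adj G b c ≡ true
    a≢c     : a ≢ c

module _ {n : ℕ} (G : Graph n) where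

  reach⇒≡⊎adj⊎path₃ : ∀ m {u v} → reach G m u v ≡ true → u ≡ v ⊎ adj G u v ≡ true ⊎ Path₃ G
  reach⇒≡⊎adj⊎path₃ zero e = inj₁ (reach-zero⁻ G e)
  reach⇒≡⊎adj⊎path₃ (suc m) {u} {v} e with ∨-true⁻ e
  ... | inj₁ shorter = reach⇒≡⊎adj⊎path₃ m shorter
  ... | inj₂ step with anyFin-true⁻ _ step
  ...   | w , uw with ∧-true⁻ {reach G m u w} uw
  ...     | reach-uw , wv with reach⇒≡⊎adj⊎path₃ m reach-uw
  ...       | inj₁ refl        = inj₂ (inj₁ wv)
  ...       | inj₂ (inj₂ path) = inj₂ (inj₂ path)
  ...       | inj₂ (inj₁ uw′) with u ≟ v
  ...         | yes u≡v = inj₁ u≡v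
  ...         | no  u≢v = inj₂ (inj₂ (record { ab = uw′ ; bc = wv ; a≢c = u≢v }))

  acyclic⇒triangle-free : Acyclic G → ∀ {a b c} → adj G a b ≡ true → adj G b c ≡ true →
                          a ≢ c → adj G c a ≡ true → ⊥
  acyclic⇒triangle-free acyclic {a} {b} {c} ab bc a≢c ca =
    acyclic 0 (record { c = vertex ; inj = injective ; steps = steps ; close = ca })
    where
      vertex : Fin 3 → Fin n
      vertex zero             = a
      vertex (suc zero)       = b
      vertex (suc (suc zero)) = c
      injective : ∀ {i j} → vertex i ≡ vertex j → i ≡ j
      injective {zero}             {zero}             _ = refl
      injective {zero}             {suc zero}         e = contradiction e (adj⇒≢ G ab)
      injective {zero}             {suc (suc zero)}   e = contradiction e a≢c
      injective {suc zero}         {zero}             e = contradiction (sym e) (adj⇒≢ G ab)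
      injective {suc zero}         {suc zero}         _ = refl
      injective {suc zero}         {suc (suc zero)}   e = contradiction e (adj⇒≢ G bc)
      injective {suc (suc zero)}   {zero}             e = contradiction (sym e) a≢c
      injective {suc (suc zero)}   {suc zero}         e = contradiction (sym e) (adj⇒≢ G bc)
      injective {suc (suc zero)}   {suc (suc zero)}   _ = refl
      steps : ∀ (i : Fin 2) → adj G (vertex (inject₁ i)) (vertex (suc i)) ≡ true
      steps zero       = ab
      steps (suc zero) = bc

-- Walks from 0 to 1 and from 0 to 2 either already contain a path a–b–c, or are both
-- edges and 1–0–2 is one.
connected⇒path₃ : ∀ {m} (G : Graph (3 + m)) → Connected G → Path₃ G
connected⇒path₃ G connected with connected zero (suc zero) | connected zero (suc (suc zero))
... | m₁ , r₁ | m₂ , r₂ with reach⇒≡⊎adj⊎path₃ G m₁ r₁ | reach⇒≡⊎adj⊎path₃ G m₂ r₂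
... | inj₂ (inj₂ path) | _                = path
... | _                | inj₂ (inj₂ path) = path
... | inj₂ (inj₁ e₁)   | inj₂ (inj₁ e₂)   =
  record { ab = trans (Graph.sym G (suc zero) zero) e₁ ; bc = e₂ ; a≢c = λ () }

tree-resolving : ∀ {m} k (T : Graph (3 + m)) → IsTree T →
                 ∃[ R ] IsTruncResolving T (suc k) R × 2 + ∣ R ∣ ≤ 3 + m
tree-resolving k T (connected , acyclic) =
  ∁ ⁅ a ⁆ - b ,
  ∁pair-resolving T {suc k} (a≢c ∘ sym) (adj⇒≢ T bc ∘ sym) separates ,
  ∣∁⁅x⁆-y∣+2≤n (adj⇒≢ T ab)
  where
    open Path₃ (connected⇒path₃ T connected)
    separates : dtrunc T (suc k) a c ≢ dtrunc T (suc k) b c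
    separates d≡ with dtrunc≡1⇒ T k (trans d≡ (dtrunc-adj T k bc))
    ... | inj₁ a≡c = a≢c a≡c
    ... | inj₂ ac  = acyclic⇒triangle-free T acyclic ab bc a≢c (trans (Graph.sym T c a) ac)

star-resolving⇒n≤2+∣R∣ : ∀ {m} k {R} → IsTruncResolving (star (suc m)) (suc k) R → suc m ≤ 2 + ∣ R ∣
star-resolving⇒n≤2+∣R∣ {m} k {centre ∷ leaves} (_ , resolves) =
  ≤-trans (s≤s (∉-unique⇒n≤1+∣p∣ leaves twins)) (s≤s (s≤s (∣p∣≤∣x∷p∣ centre leaves)))
  where
    S = star (suc m)
    twins : ∀ {i j} → i ∉ leaves → j ∉ leaves → i ≡ j
    twins {i} {j} i∉ j∉ = suc-injective (resolves (suc i) (suc j) same)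
      where
        same : ∀ r → r ∈ centre ∷ leaves → dtrunc S (suc k) (suc i) r ≡ dtrunc S (suc k) (suc j) r
        same zero    _  = trans (dtrunc-adj S k {suc i} {zero} refl)
                                (sym (dtrunc-adj S k {suc j} {zero} refl))
        same (suc l) l∈ = trans (dtrunc-two S k zero (i∉ ∘ ∈leaves) refl refl refl)
                                (sym (dtrunc-two S k zero (j∉ ∘ ∈leaves) refl refl refl))
          where
            ∈leaves : ∀ {x} → suc x ≡ suc l → x ∈ leaves
            ∈leaves refl = drop-there l∈

lemma7 : (k n : ℕ) → 1 ≤ k → 2 < n → (T : Graph n) → IsTree T →
    (b₁ b₂ : ℕ) → IsTruncMetricDim T k b₁ → IsTruncMetricDim (star n) k b₂ →
    b₁ ≤ b₂
lemma7 (suc k) (suc (suc (suc m))) (s≤s z≤n) (s≤s (s≤s (s≤s z≤n))) T tree b₁ b₂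
       (_ , minimal) ((R₂ , resolving₂ , refl) , _)
  with tree-resolving k T tree
... | R₁ , resolving₁ , 2+∣R₁∣≤n =
  ≤-trans (minimal R₁ resolving₁)
          (+-cancelˡ-≤ 2 _ _ (≤-trans 2+∣R₁∣≤n (star-resolving⇒n≤2+∣R∣ k resolving₂)))
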